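{- Let $S=(X^t,X^s,T,\prec,M)$ be a DM-compact dynamic mereotopological space, and let $(Clusters(S^+),\prec^+)$ be the canonical time structure of $S^+$, where $\Gamma\prec^+\Delta$ iff $a\mathcal{B}b$ for all $a\in\Gamma$, $b\in\Delta$. (i) For each time condition $\Phi$ among (RS), (LS), (Up Dir), (Down Dir), (Circ), (Dens), (Ref), (Irr), (Lin), (Tr): $\Phi$ holds in $(T,\prec)$ iff $\Phi$ holds in $(Clusters(S^+),\prec^+)$. (ii) If moreover $X^t$ is $T_0$, then (Tri) holds in $(T,\prec)$ iff (Tri) holds in $(Clusters(S^+),\prec^+)$.
   Context: A DMS is $S=(X^t,X^s,T,\prec,M)$ with $X^t$ a nonempty topological space, $M$ a Boolean subalgebra of the regular closed sets $RC(X^t)$ forming a closed base, $X^s,T$ nonempty subsets of $X^t$, every nonempty regular closed set meets $X^s$, $\prec$ a binary relation on $X^t$; on $M$: $aC^tb$ iff $a\cap b\neq\emptyset$, $aC^sb$ iff $a\cap b\cap X^s\neq\emptyset$, $a\mathcal{B}b$ iff $\exists x\in a,y\in b\,(x\prec y)$; $S^+=(M,C^s,C^t,\mathcal{B})$; $\rho_S(x)=\{a\in M:x\in a\}$; axioms: $S^+$ is a dynamic contact algebra (Boolean algebra with $0\neq1$, contact relations $C^s\subseteq C^t$, precontact $\mathcal{B}$, with $a\overline{C^t}b\Rightarrow\exists c(a\overline{C^t}c\wedge c^*\overline{C^t}b)$, $a\overline{\mathcal{B}}b\Rightarrow\exists c(a\overline{C^t}c\wedge c^*\overline{\mathcal{B}}b)$,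 $a\overline{\mathcal{B}}b\Rightarrow\exists c(a\overline{\mathcal{B}}c\wedge c^*\overline{C^t}b)$); $x\prec y$ iff $\forall a,b\in M(x\in a,y\in b\Rightarrow a\mathcal{B}b)$; $\rho_S(x)$ is a cluster for $x\in T$. t-clans (s-clans): nonempty-proper upward closed prime subsets $\Gamma$ ($1\in\Gamma,0\notin\Gamma$, $a+b\in\Gamma\Rightarrow a\in\Gamma\vee b\in\Gamma$) whose elements are pairwise $C^t$- (resp. $C^s$-) related; clusters: t-clans $\Gamma$ with $\forall a\notin\Gamma\exists b\in\Gamma\,a\overline{C^t}b$. DM-compact: every t-clan, s-clan, cluster of $S^+$ is $\rho_S(x)$ for some $x$ in $X^t$, $X^s$, $T$ respectively. Time conditions on $(T,\prec)$: (RS) $\forall m\exists n\,m\prec n$; (LS) $\forall m\exists n\,n\prec m$; (Up Dir) $\forall i,j\exists k(i\prec k\wedge j\prec k)$; (Down Dir) $\forall i,j\exists k(k\prec i\wedge k\prec j)$; (Circ) $i\prec j\Rightarrow\exists k(j\prec k\wedge k\prec i)$; (Dens) $i\prec j\Rightarrow\exists k(i\prec k\wedge k\prec j)$; (Ref) $\forall m\,m\prec m$; (Irr) $\forall m\,\neg m\prec m$; (Lin) $\forall m,n(m\prec n\vee n\prec m)$; (Tri) $\forall m,n(m=n\vee m\prec n\vee n\prec m)$; (Tr) transitivity. -}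

module Defs where

open import Level using (Level; _⊔_; 0ℓ) renaming (suc to lsuc)
open import Data.Product using (Σ; ∃; _×_; _,_; proj₁; proj₂)
open import Data.Sum using (_⊎_)
open import Relation.Nullary using (¬_)
open import Relation.Binary.PropositionalEquality using (_≡_)
open import Relation.Unary using (Pred; _⊆_; _≐_; ∅; U; _∪_; _∩_; ∁; Satisfiable)
open import Function.Bundles using (_⇔_)
open import Function.Base using (_∋_)

record Topology (X : Set) : Set₁ where
  field
    Open   : Pred X 0ℓ → Set
    open-U : Open U
    open-∅ : Open ∅
    open-∩ : ∀ {A B} → Open A → Open B → Open (A ∩ B)
    open-⋃ : ∀ {I : Set} (A : I → Pred X 0ℓ) → (∀ i → Open (A i)) →
             Open (λ x → Σ I λ i → A i x)
    open-≐ : ∀ {A B} → A ≐ B → Open A → Open B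

  cl : ∀ {ℓ} → Pred X ℓ → Pred X (lsuc 0ℓ ⊔ ℓ)
  cl A x = (V : Pred X 0ℓ) → Open V → V x → Σ X λ y → V y × A y

  int : ∀ {ℓ} → Pred X ℓ → Pred X (lsuc 0ℓ ⊔ ℓ)
  int A x = Σ (Pred X 0ℓ) λ V → Open V × V x × V ⊆ A

  Closed : Pred X 0ℓ → Set₁
  Closed A = cl A ⊆ A

  RegClosed : Pred X 0ℓ → Set₁
  RegClosed A = A ≐ cl (int A)

  T₀ : Set₁
  T₀ = ∀ (x y : X) → ¬ (x ≡ y) →
       Σ (Pred X 0ℓ) λ V → Open V × ((V x × ¬ V y) ⊎ (V y × ¬ V x))

module TimeConditions {a ℓ : Level} (W : Set a) (_<_ : W → W → Set ℓ) where

  RS LS UpDir DownDir Circ Dens Ref Irr Lin Tr : Set (a ⊔ ℓ)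
  RS      = ∀ m → ∃ λ n → m < n
  LS      = ∀ m → ∃ λ n → n < m
  UpDir   = ∀ i j → ∃ λ k → i < k × j < k
  DownDir = ∀ i j → ∃ λ k → k < i × k < j
  Circ    = ∀ i j → i < j → ∃ λ k → j < k × k < i
  Dens    = ∀ i j → i < j → ∃ λ k → i < k × k < j
  Ref     = ∀ m → m < m
  Irr     = ∀ m → ¬ (m < m)
  Lin     = ∀ m n → m < n ⊎ n < m
  Tr      = ∀ i j k → i < j → j < k → i < k

  Tri : ∀ {e} (_≈_ : W → W → Set e) → Set (a ⊔ ℓ ⊔ e)
  Tri _≈_ = ∀ m n → m ≈ n ⊎ (m < n ⊎ n < m)

data TimeCondition : Set where
  RS LS UpDir DownDir Circ Dens Ref Irr Lin Tr : TimeCondition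

Holds : ∀ {a ℓ} (W : Set a) (_<_ : W → W → Set ℓ) → TimeCondition → Set (a ⊔ ℓ)
Holds W _<_ RS      = TimeConditions.RS W _<_
Holds W _<_ LS      = TimeConditions.LS W _<_
Holds W _<_ UpDir   = TimeConditions.UpDir W _<_
Holds W _<_ DownDir = TimeConditions.DownDir W _<_
Holds W _<_ Circ    = TimeConditions.Circ W _<_
Holds W _<_ Dens    = TimeConditions.Dens W _<_
Holds W _<_ Ref     = TimeConditions.Ref W _<_
Holds W _<_ Irr     = TimeConditions.Irr W _<_
Holds W _<_ Lin     = TimeConditions.Lin W _<_
Holds W _<_ Tr      = TimeConditions.Tr W _<_

module DMSNotions (X : Set) (top : Topology X) (Xs T : Pred X 0ℓ)
                  (_≺_ : X → X → Set) (M : Pred (Pred X 0ℓ) 0ℓ) where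
  open Topology top

  Region : Set₁
  Region = Pred X 0ℓ

  Ct Cs 𝓑 : Region → Region → Set
  Ct a b = Σ X λ x → a x × b x
  Cs a b = Σ X λ x → a x × b x × Xs x
  𝓑 a b  = Σ X λ x → Σ X λ y → a x × b y × x ≺ y

  -- Boolean operations of RC(X) (as relations: c is the meet / complement)
  IsMeet : Region → Region → Region → Set₁
  IsMeet a b c = c ≐ cl (int (a ∩ b))

  IsComp : Region → Region → Set₁
  IsComp a c = c ≐ cl (∁ a)

  Nonzero : Region → Set
  Nonzero a = ¬ (a ≐ ∅)

  record IsPrecontact (R : Region → Region → Set) : Set₁ where
    field
      C1  : ∀ {a b} → M a → M b → R a b → Nonzero a × Nonzero b
      C2r : ∀ {a b c} → M a → M b → M c → R a (b ∪ c) ⇔ (R a b ⊎ R a c)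
      C2l : ∀ {a b c} → M a → M b → M c → R (a ∪ b) c ⇔ (R a c ⊎ R b c)

  record IsContact (R : Region → Region → Set) : Set₁ where
    field
      precontact : IsPrecontact R
      C3 : ∀ {a b} → M a → M b → R a b → R b a
      C4 : ∀ {a b c} → M a → M b → M c → IsMeet a b c → Nonzero c → R a b

  -- S⁺ = (M, Cs, Ct, 𝓑) is a dynamic contact algebra
  -- (the Boolean algebra part is the subalgebra condition below)
  record IsDCA : Set₁ where
    field
      zero≢one   : ¬ ((Region ∋ U) ≐ (Region ∋ ∅))
      Cs-contact : IsContact Cs
      Ct-contact : IsContact Ct
      𝓑-precontact : IsPrecontact 𝓑
      Cs⊆Ct : ∀ {a b} → M a → M b → Cs a b → Ct a b
      ext-Ct : ∀ {a b} → M a → M b → ¬ Ct a b →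
               Σ Region λ c → Σ Region λ c* → M c × M c* × IsComp c c* ×
                 ¬ Ct a c × ¬ Ct c* b
      ext-𝓑₁ : ∀ {a b} → M a → M b → ¬ 𝓑 a b →
               Σ Region λ c → Σ Region λ c* → M c × M c* × IsComp c c* ×
                 ¬ Ct a c × ¬ 𝓑 c* b
      ext-𝓑₂ : ∀ {a b} → M a → M b → ¬ 𝓑 a b →
               Σ Region λ c → Σ Region λ c* → M c × M c* × IsComp c c* ×
                 ¬ 𝓑 a c × ¬ Ct c* b

  ρ : X → Pred Region 0ℓ
  ρ x a = M a × a x

  -- clans w.r.t. a contact relation R (t-clans: R = Ct, s-clans: R = Cs)
  record IsClan (R : Region → Region → Set) (Γ : Pred Region 0ℓ) : Set₁ where
    field
      Γ⊆M   : ∀ {a} → Γ a → M a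
      up    : ∀ {a b} → Γ a → M b → a ⊆ b → Γ b
      one∈  : Γ U
      zero∉ : ¬ Γ ∅
      prime : ∀ {a b} → M a → M b → Γ (a ∪ b) → Γ a ⊎ Γ b
      pairwise : ∀ {a b} → Γ a → Γ b → R a b

  record IsCluster (Γ : Pred Region 0ℓ) : Set₁ where
    field
      tclan : IsClan Ct Γ
      maximal : ∀ a → M a → ¬ Γ a → Σ Region λ b → Γ b × ¬ Ct a b

  record IsDMS : Set₁ where
    field
      X-nonempty  : X
      Xs-nonempty : Satisfiable Xs
      T-nonempty  : Satisfiable T
      M-regClosed : ∀ {a} → M a → RegClosed a
      M-≐    : ∀ {a b} → a ≐ b → M a → M b
      M-zero : M ∅
      M-one  : M U
      M-join : ∀ {a b} → M a → M b → M (a ∪ b)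
      M-meet : ∀ {a b} → M a → M b → Σ Region λ c → M c × IsMeet a b c
      M-comp : ∀ {a} → M a → Σ Region λ c → M c × IsComp a c
      closedBase : ∀ (F : Region) → Closed F → ∀ x → ¬ F x →
                   Σ Region λ a → M a × F ⊆ a × ¬ a x
      Xs-dense : ∀ (A : Region) → RegClosed A → Satisfiable A → Satisfiable (A ∩ Xs)
      dca : IsDCA
      ≺-char : ∀ x y → x ≺ y ⇔ (∀ a b → M a → M b → a x → b y → 𝓑 a b)
      ρ-cluster : ∀ x → T x → IsCluster (ρ x)

  DMCompact : Set₁
  DMCompact =
      (∀ Γ → IsClan Ct Γ → Σ X λ x → Γ ≐ ρ x)
    × (∀ Γ → IsClan Cs Γ → Σ X λ x → Xs x × Γ ≐ ρ x)
    × (∀ Γ → IsCluster Γ → Σ X λ x → T x × Γ ≐ ρ x)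

  TPoint : Set
  TPoint = Σ X T

  _≺T_ : TPoint → TPoint → Set
  m ≺T n = proj₁ m ≺ proj₁ n

  _≡T_ : TPoint → TPoint → Set
  m ≡T n = proj₁ m ≡ proj₁ n

  Cluster : Set₁
  Cluster = Σ (Pred Region 0ℓ) IsCluster

  _≺⁺_ : Cluster → Cluster → Set₁
  Γ ≺⁺ Δ = ∀ a b → proj₁ Γ a → proj₁ Δ b → 𝓑 a b

  _≈⁺_ : Cluster → Cluster → Set₁
  Γ ≈⁺ Δ = proj₁ Γ ≐ proj₁ Δ

record DMS : Set₁ where
  field
    X   : Set
    top : Topology X
    Xs  : Pred X 0ℓ
    T   : Pred X 0ℓ
    _≺_ : X → X → Set
    M   : Pred (Pred X 0ℓ) 0ℓ
    isDMS : DMSNotions.IsDMS X top Xs T _≺_ M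

  open DMSNotions X top Xs T _≺_ M public
  open Topology top public using (T₀)

-- The map x ↦ ρ x is an embedding of (T, ≺) into (Clusters(S⁺), ≺⁺) by the axiom
-- characterising ≺, and DM-compactness makes it surjective up to equality of clusters as
-- sets, which ≺⁺ cannot distinguish. Every time condition only speaks about ≺, so it
-- transfers along such an embedding in both directions. (Tri) additionally speaks about
-- equality, and transfers once ρ is injective: if x ≠ y, a T₀-separating open set V
-- has complement ∁ V closed, so the closed base yields a ∈ M containing ∁ V but missing
-- the point in V, which places a in exactly one of ρ x and ρ y.
module Submission where

open import Defs
open import Level using (0ℓ; lift; lower) renaming (suc to lsuc)
open import Data.Product using (_×_; _,_; proj₁; proj₂)
open import Data.Sum using (inj₁; inj₂) renaming (map to ⊎-map)
open import Function.Base using (_∘_)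
open import Function.Bundles using (_⇔_; mk⇔; Equivalence)
open import Relation.Nullary using (¬_)
open import Relation.Unary using (∁; _⊆_; _≐_)
open import Relation.Unary.Properties using (≐-refl; ≐-sym; ≐-trans)
open import Relation.Binary.Core using (Rel)
open import Relation.Binary.Definitions using (_Respects₂_)
open import Relation.Binary.Structures using (IsEquivalence)
open import Relation.Binary.Morphism.Structures using (IsRelMonomorphism)
open import Relation.Binary.PropositionalEquality using (_≡_; subst)
open import Axiom.ExcludedMiddle using (ExcludedMiddle)
open import Axiom.DoubleNegationElimination using (em⇒dne)

open Equivalence using (to; from)

module TimeConditionTransfer
  {a b ℓ₁ ℓ₂ e} {W : Set a} {W′ : Set b}
  {_<_ : Rel W ℓ₁} {_<′_ : Rel W′ ℓ₂} {_≈′_ : Rel W′ e}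
  (≈′-isEquivalence : IsEquivalence _≈′_)
  (<′-resp-≈′ : _<′_ Respects₂ _≈′_)
  {embed : W → W′} (embed-mono : IsRelMonomorphism _<_ _<′_ embed)
  (pick : W′ → W) (embed-pick : ∀ w → embed (pick w) ≈′ w)
  where

  open IsEquivalence ≈′-isEquivalence using (sym; trans)
  open IsRelMonomorphism embed-mono using (cong; injective)

  <-pickˡ⇔ : ∀ {w y} → pick w < y ⇔ w <′ embed y
  <-pickˡ⇔ {w} = mk⇔ (proj₂ <′-resp-≈′ (embed-pick w) ∘ cong)
                     (injective ∘ proj₂ <′-resp-≈′ (sym (embed-pick w)))

  <-pickʳ⇔ : ∀ {x w} → x < pick w ⇔ embed x <′ w
  <-pickʳ⇔ {w = w} = mk⇔ (proj₁ <′-resp-≈′ (embed-pick w) ∘ cong)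
                         (injective ∘ proj₁ <′-resp-≈′ (sym (embed-pick w)))

  <-pick⇔ : ∀ {w v} → pick w < pick v ⇔ w <′ v
  <-pick⇔ {w} {v} = mk⇔ (proj₂ <′-resp-≈′ (embed-pick w) ∘ to <-pickʳ⇔)
                        (from <-pickʳ⇔ ∘ proj₂ <′-resp-≈′ (sym (embed-pick w)))

  holds⇒holds′ : ∀ Φ → Holds W _<_ Φ → Holds W′ _<′_ Φ
  holds⇒holds′ RS h w with h (pick w)
  ... | n , p = embed n , to <-pickˡ⇔ p
  holds⇒holds′ LS h w with h (pick w)
  ... | n , p = embed n , to <-pickʳ⇔ p
  holds⇒holds′ UpDir h w v with h (pick w) (pick v)
  ... | k , p , q = embed k , to <-pickˡ⇔ p , to <-pickˡ⇔ q
  holds⇒holds′ DownDir h w v with h (pick w) (pick v)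
  ... | k , p , q = embed k , to <-pickʳ⇔ p , to <-pickʳ⇔ q
  holds⇒holds′ Circ h w v r with h (pick w) (pick v) (from <-pick⇔ r)
  ... | k , p , q = embed k , to <-pickˡ⇔ p , to <-pickʳ⇔ q
  holds⇒holds′ Dens h w v r with h (pick w) (pick v) (from <-pick⇔ r)
  ... | k , p , q = embed k , to <-pickˡ⇔ p , to <-pickʳ⇔ q
  holds⇒holds′ Ref h w = to <-pick⇔ (h (pick w))
  holds⇒holds′ Irr h w = h (pick w) ∘ from <-pick⇔
  holds⇒holds′ Lin h w v = ⊎-map (to <-pick⇔) (to <-pick⇔) (h (pick w) (pick v))
  holds⇒holds′ Tr h u w v r s =
    to <-pick⇔ (h (pick u) (pick w) (pick v) (from <-pick⇔ r) (from <-pick⇔ s))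

  holds′⇒holds : ∀ Φ → Holds W′ _<′_ Φ → Holds W _<_ Φ
  holds′⇒holds RS h m with h (embed m)
  ... | w , p = pick w , from <-pickʳ⇔ p
  holds′⇒holds LS h m with h (embed m)
  ... | w , p = pick w , from <-pickˡ⇔ p
  holds′⇒holds UpDir h m n with h (embed m) (embed n)
  ... | w , p , q = pick w , from <-pickʳ⇔ p , from <-pickʳ⇔ q
  holds′⇒holds DownDir h m n with h (embed m) (embed n)
  ... | w , p , q = pick w , from <-pickˡ⇔ p , from <-pickˡ⇔ q
  holds′⇒holds Circ h m n r with h (embed m) (embed n) (cong r)
  ... | w , p , q = pick w , from <-pickʳ⇔ p , from <-pickˡ⇔ q
  holds′⇒holds Dens h m n r with h (embed m) (embed n) (cong r)
  ... | w , p , q = pick w , from <-pickʳ⇔ p , from <-pickˡ⇔ q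
  holds′⇒holds Ref h m = injective (h (embed m))
  holds′⇒holds Irr h m = h (embed m) ∘ cong
  holds′⇒holds Lin h m n = ⊎-map injective injective (h (embed m) (embed n))
  holds′⇒holds Tr h i j k r s = injective (h (embed i) (embed j) (embed k) (cong r) (cong s))

  holds⇔holds′ : ∀ Φ → Holds W _<_ Φ ⇔ Holds W′ _<′_ Φ
  holds⇔holds′ Φ = mk⇔ (holds⇒holds′ Φ) (holds′⇒holds Φ)

  tri⇔tri′ : ∀ {ℓ} {_≈_ : Rel W ℓ} → IsRelMonomorphism _≈_ _≈′_ embed →
             TimeConditions.Tri W _<_ _≈_ ⇔ TimeConditions.Tri W′ _<′_ _≈′_
  tri⇔tri′ {_≈_ = _≈_} ≈-mono = mk⇔ tri⇒tri′ tri′⇒tri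
    where
    open IsRelMonomorphism ≈-mono renaming (cong to ≈-cong; injective to ≈-injective)

    tri⇒tri′ : TimeConditions.Tri W _<_ _≈_ → TimeConditions.Tri W′ _<′_ _≈′_
    tri⇒tri′ h w v with h (pick w) (pick v)
    ... | inj₁ w≈v = inj₁ (trans (sym (embed-pick w)) (trans (≈-cong w≈v) (embed-pick v)))
    ... | inj₂ r   = inj₂ (⊎-map (to <-pick⇔) (to <-pick⇔) r)

    tri′⇒tri : TimeConditions.Tri W′ _<′_ _≈′_ → TimeConditions.Tri W _<_ _≈_
    tri′⇒tri h m n = ⊎-map ≈-injective (⊎-map injective injective) (h (embed m) (embed n))

module _ {X : Set} (top : Topology X) where
  open Topology top

  ∁-open-closed : ∀ {V} → Open V → Closed (∁ V)
  ∁-open-closed {V} V-open x∈cl∁V Vx with x∈cl∁V V V-open Vx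
  ... | y , Vy , ¬Vy = ¬Vy Vy

module _ (S : DMS) where
  open DMS S
  open IsDMS isDMS
  open Topology top using (Open)

  ρ⁺ : TPoint → Cluster
  ρ⁺ (x , Tx) = ρ x , ρ-cluster x Tx

  ρ⁺-mono : IsRelMonomorphism _≺T_ _≺⁺_ ρ⁺
  ρ⁺-mono = record
    { isHomomorphism = record
      { cong = λ m≺n a b (Ma , ax) (Mb , bn) → to (≺-char _ _) m≺n a b Ma Mb ax bn }
    ; injective = λ h → from (≺-char _ _) λ a b Ma Mb ax by → h a b (Ma , ax) (Mb , by)
    }

  ≈⁺-isEquivalence : IsEquivalence _≈⁺_
  ≈⁺-isEquivalence = record { refl = ≐-refl ; sym = ≐-sym ; trans = ≐-trans }

  ≺⁺-resp-≈⁺ : _≺⁺_ Respects₂ _≈⁺_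
  ≺⁺-resp-≈⁺ = (λ Δ≐Δ′ h a b Γa Δ′b → h a b Γa (proj₂ Δ≐Δ′ Δ′b))
             , (λ Γ≐Γ′ h a b Γ′a Δb → h a b (proj₂ Γ≐Γ′ Γ′a) Δb)

  module _ (dmc : DMCompact) where

    clusterPoint : Cluster → TPoint
    clusterPoint (Γ , Γ-cluster) with proj₂ (proj₂ dmc) Γ Γ-cluster
    ... | x , Tx , _ = x , Tx

    ρ⁺-clusterPoint : ∀ Γ → ρ⁺ (clusterPoint Γ) ≈⁺ Γ
    ρ⁺-clusterPoint (Γ , Γ-cluster) with proj₂ (proj₂ dmc) Γ Γ-cluster
    ... | _ , _ , Γ≐ρx = ≐-sym Γ≐ρx

    open TimeConditionTransfer
      ≈⁺-isEquivalence ≺⁺-resp-≈⁺ ρ⁺-mono clusterPoint ρ⁺-clusterPoint public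

  separated⇒ρ⊈ρ : ∀ {V x y} → Open V → V x → ¬ V y → ¬ (ρ y ⊆ ρ x)
  separated⇒ρ⊈ρ {V} {x} V-open Vx ¬Vy ρy⊆ρx
    with closedBase (∁ V) (∁-open-closed top V-open) x (λ ¬Vx → ¬Vx Vx)
  ... | a , Ma , ∁V⊆a , ¬ax = ¬ax (proj₂ (ρy⊆ρx (Ma , ∁V⊆a ¬Vy)))

  ρ-injective : T₀ → ∀ {x y} → ρ x ≐ ρ y → ¬ ¬ (x ≡ y)
  ρ-injective t₀ {x} {y} (ρx⊆ρy , ρy⊆ρx) x≢y with t₀ x y x≢y
  ... | V , V-open , inj₁ (Vx , ¬Vy) = separated⇒ρ⊈ρ V-open Vx ¬Vy ρy⊆ρx
  ... | V , V-open , inj₂ (Vy , ¬Vx) = separated⇒ρ⊈ρ V-open Vy ¬Vx ρx⊆ρy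

  ρ⁺-≡-mono : ExcludedMiddle (lsuc 0ℓ) → T₀ → IsRelMonomorphism _≡T_ _≈⁺_ ρ⁺
  ρ⁺-≡-mono em t₀ = record
    { isHomomorphism = record
      { cong = λ {m} m≡n → subst (λ y → ρ (proj₁ m) ≐ ρ y) m≡n ≐-refl }
    ; injective = λ ρx≐ρy →
        lower (em⇒dne em λ ¬x≡y → ρ-injective t₀ ρx≐ρy (¬x≡y ∘ lift))
    }

lemma5p17 : ExcludedMiddle (lsuc 0ℓ) → (S : DMS) → DMS.DMCompact S →
    ((Φ : TimeCondition) →
    Holds (DMS.TPoint S) (DMS._≺T_ S) Φ ⇔ Holds (DMS.Cluster S) (DMS._≺⁺_ S) Φ)
    × (DMS.T₀ S →
    TimeConditions.Tri (DMS.TPoint S) (DMS._≺T_ S) (DMS._≡T_ S)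
    ⇔ TimeConditions.Tri (DMS.Cluster S) (DMS._≺⁺_ S) (DMS._≈⁺_ S))
lemma5p17 em S dmc = holds⇔holds′ S dmc , λ t₀ → tri⇔tri′ S dmc (ρ⁺-≡-mono S em t₀)
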